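{- Let $x\in\{0,1\}^{\mathbb N}$ and $a\in\{0,1\}$. Suppose $x$ admits a factorisation $x=u_1u_2u_3\cdots$ where each $u_i$ is a (non-empty) prefix of $x$ that is rich in $a$. Then $x$ is periodic.
   Context: For an infinite word $x$ and a letter $a$, a factor (finite contiguous subword) $u$ of $x$ is rich in $a$ if $|u|_a\geq|v|_a$ for all factors $v$ of $x$ with $|v|=|u|$, where $|w|_a$ denotes the number of occurrences of $a$ in $w$. An infinite word $x$ is periodic if $x=uuu\cdots$ for some non-empty finite word $u$. -}

module Defs where

open import Data.Nat using (ℕ; zero; suc; _+_; _≤_; _<_)
open import Data.Fin using (Fin)
open import Data.Product using (Σ; ∃; _×_; _,_)
open import Relation.Binary.PropositionalEquality using (_≡_)
open import Relation.Nullary using (Dec; yes; no)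
open import Data.Fin using (_≟_)

Letter : Set
Letter = Fin 2

Word : Set
Word = ℕ → Letter

occ : Word → Letter → ℕ → ℕ → ℕ
occ x a i zero = 0
occ x a i (suc n) with x i ≟ a
... | yes _ = suc (occ x a (suc i) n)
... | no  _ = occ x a (suc i) n

RichFactor : Word → Letter → ℕ → ℕ → Set
RichFactor x a i n = ∀ j → occ x a j n ≤ occ x a i n

RichPrefix : Word → Letter → ℕ → Set
RichPrefix x a n = RichFactor x a 0 n

start : (ℕ → ℕ) → ℕ → ℕ
start ℓ zero    = 0
start ℓ (suc k) = start ℓ k + ℓ k

-- x = u₀ u₁ u₂ ⋯ where u_k is the factor of length ℓ k starting at start ℓ k,
-- each u_k is non-empty, equals the prefix of x of the same length,
-- and that prefix is rich in a.
RichPrefixFactorisation : Word → Letter → Set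
RichPrefixFactorisation x a =
  Σ (ℕ → ℕ) λ ℓ →
    ∀ k → (1 ≤ ℓ k)
        × (∀ j → j < ℓ k → x (start ℓ k + j) ≡ x j)
        × RichPrefix x a (ℓ k)

Periodic : Word → Set
Periodic x = ∃ λ p → (1 ≤ p) × (∀ n → x (n + p) ≡ x n)

-- Let Sₖ = |u₀ ⋯ uₖ₋₁|. We show x (Sₖ + n) = x n for all k by strong induction on n,
-- so S₁ = |u₀| is a period. Prefixes of the form u₀ ⋯ uₖ₋₁ are rich, being
-- concatenations of rich factors. If the prefix of length L is rich and
-- x (L + j) = x j for j < t, sliding a window of length L from 0 to t + 1 shows that
-- x (L + t) contains no more a's than x t. Taking L = Sₖ gives one inequality
-- between x (Sₖ + n) and x n; for the other, write n = D + t with Sₖ + D = Sₖ₊d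
-- the start of the block uₖ₊d containing position Sₖ + n, and take L = D.
-- Over a binary alphabet the two inequalities force equal letters.
module Submission where

open import Defs
open import Data.Nat using (ℕ; zero; suc; _+_; _≤_; _<_; z≤n; s≤s)
open import Data.Nat.Properties hiding (_≟_)
open import Data.Nat.Induction using (<-rec)
open import Data.Fin using (_≟_)
open import Data.Fin.Patterns using (0F; 1F)
open import Data.Product using (∃₂; _×_; _,_; proj₁; proj₂)
open import Data.Sum using (inj₁; inj₂)
open import Relation.Binary.PropositionalEquality
open import Relation.Nullary using (yes; no)

count : Letter → Letter → ℕ
count a b with b ≟ a
... | yes _ = 1
... | no  _ = 0

count-injective : ∀ a {b c} → count a b ≡ count a c → b ≡ c
count-injective 0F {0F} {0F} _  = refl
count-injective 0F {1F} {1F} _  = refl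
count-injective 1F {0F} {0F} _  = refl
count-injective 1F {1F} {1F} _  = refl
count-injective 0F {0F} {1F} ()
count-injective 0F {1F} {0F} ()
count-injective 1F {0F} {1F} ()
count-injective 1F {1F} {0F} ()

module Occurrences (x : Word) (a : Letter) where

  occ-suc : ∀ i n → occ x a i (suc n) ≡ count a (x i) + occ x a (suc i) n
  occ-suc i n with x i ≟ a
  ... | yes _ = refl
  ... | no  _ = refl

  occ-+ : ∀ i m n → occ x a i (m + n) ≡ occ x a i m + occ x a (i + m) n
  occ-+ i zero    n rewrite +-identityʳ i = refl
  occ-+ i (suc m) n = begin
    occ x a i (suc (m + n))
      ≡⟨ occ-suc i (m + n) ⟩
    count a (x i) + occ x a (suc i) (m + n)
      ≡⟨ cong (count a (x i) +_) (occ-+ (suc i) m n) ⟩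
    count a (x i) + (occ x a (suc i) m + occ x a (suc i + m) n)
      ≡⟨ +-assoc (count a (x i)) _ _ ⟨
    count a (x i) + occ x a (suc i) m + occ x a (suc i + m) n
      ≡⟨ cong₂ _+_ (occ-suc i m) (cong (λ j → occ x a j n) (+-suc i m)) ⟨
    occ x a i (suc m) + occ x a (i + suc m) n
      ∎
    where open ≡-Reasoning

  occ-one : ∀ i → occ x a i 1 ≡ count a (x i)
  occ-one i = trans (occ-suc i 0) (+-identityʳ _)

  occ-window-step : ∀ i L → occ x a i L + count a (x (i + L)) ≡ count a (x i) + occ x a (suc i) L
  occ-window-step i L = begin
    occ x a i L + count a (x (i + L))     ≡⟨ cong (occ x a i L +_) (occ-one (i + L)) ⟨
    occ x a i L + occ x a (i + L) 1       ≡⟨ occ-+ i L 1 ⟨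
    occ x a i (L + 1)                     ≡⟨ cong (occ x a i) (+-comm L 1) ⟩
    occ x a i (suc L)                     ≡⟨ occ-suc i L ⟩
    count a (x i) + occ x a (suc i) L     ∎
    where open ≡-Reasoning

  occ-cong : ∀ {i i'} n → (∀ j → j < n → x (i + j) ≡ x (i' + j)) → occ x a i n ≡ occ x a i' n
  occ-cong zero    _ = refl
  occ-cong {i} {i'} (suc n) same = begin
    occ x a i (suc n)                     ≡⟨ occ-suc i n ⟩
    count a (x i) + occ x a (suc i) n     ≡⟨ cong₂ _+_ (cong (count a) first) (occ-cong n rest) ⟩
    count a (x i') + occ x a (suc i') n   ≡⟨ occ-suc i' n ⟨
    occ x a i' (suc n)                    ∎
    where
    open ≡-Reasoning
    first : x i ≡ x i'
    first = subst₂ (λ u v → x u ≡ x v) (+-identityʳ i) (+-identityʳ i') (same 0 (s≤s z≤n))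
    rest : ∀ j → j < n → x (suc i + j) ≡ x (suc i' + j)
    rest j j<n = subst₂ (λ u v → x u ≡ x v) (+-suc i j) (+-suc i' j) (same (suc j) (s≤s j<n))

  RichFactor-++ : ∀ {i} m n → RichFactor x a i m → RichFactor x a (i + m) n → RichFactor x a i (m + n)
  RichFactor-++ {i} m n rich₁ rich₂ j = begin
    occ x a j (m + n)                       ≡⟨ occ-+ j m n ⟩
    occ x a j m + occ x a (j + m) n         ≤⟨ +-mono-≤ (rich₁ j) (rich₂ (j + m)) ⟩
    occ x a i m + occ x a (i + m) n         ≡⟨ occ-+ i m n ⟨
    occ x a i (m + n)                       ∎
    where open ≤-Reasoning

  RichFactor-cong : ∀ {i i'} n → (∀ j → j < n → x (i + j) ≡ x (i' + j)) →
                    RichFactor x a i n → RichFactor x a i' n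
  RichFactor-cong n same rich j = subst (occ x a j n ≤_) (occ-cong n same) (rich j)

  occ-shift-invariant : ∀ L t → (∀ j → j < t → x (L + j) ≡ x j) → occ x a t L ≡ occ x a 0 L
  occ-shift-invariant L zero    _      = refl
  occ-shift-invariant L (suc t) period =
    trans step (occ-shift-invariant L t (λ j j<t → period j (m<n⇒m<1+n j<t)))
    where
    step : occ x a (suc t) L ≡ occ x a t L
    step = +-cancelˡ-≡ (count a (x t)) _ _ (begin
      count a (x t) + occ x a (suc t) L     ≡⟨ occ-window-step t L ⟨
      occ x a t L + count a (x (t + L))     ≡⟨ cong (λ j → occ x a t L + count a (x j)) (+-comm t L) ⟩
      occ x a t L + count a (x (L + t))     ≡⟨ cong (λ b → occ x a t L + count a b) (period t ≤-refl) ⟩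
      occ x a t L + count a (x t)           ≡⟨ +-comm (occ x a t L) _ ⟩
      count a (x t) + occ x a t L           ∎)
      where open ≡-Reasoning

  RichPrefix-shift-count : ∀ L t → RichPrefix x a L → (∀ j → j < t → x (L + j) ≡ x j) →
                           count a (x (L + t)) ≤ count a (x t)
  RichPrefix-shift-count L t rich period = +-cancelˡ-≤ (occ x a 0 L) _ _ (begin
    occ x a 0 L + count a (x (L + t))      ≡⟨ cong (_+ count a (x (L + t))) (occ-shift-invariant L t period) ⟨
    occ x a t L + count a (x (L + t))      ≡⟨ cong (λ j → occ x a t L + count a (x j)) (+-comm L t) ⟩
    occ x a t L + count a (x (t + L))      ≡⟨ occ-window-step t L ⟩
    count a (x t) + occ x a (suc t) L      ≤⟨ +-monoʳ-≤ (count a (x t)) (rich (suc t)) ⟩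
    count a (x t) + occ x a 0 L            ≡⟨ +-comm (count a (x t)) _ ⟩
    occ x a 0 L + count a (x t)            ∎)
    where open ≤-Reasoning

span : (ℕ → ℕ) → ℕ → ℕ → ℕ
span ℓ k zero    = 0
span ℓ k (suc d) = span ℓ k d + ℓ (k + d)

start-+-span : ∀ ℓ k d → start ℓ k + span ℓ k d ≡ start ℓ (k + d)
start-+-span ℓ k zero    = trans (+-identityʳ _) (cong (start ℓ) (sym (+-identityʳ k)))
start-+-span ℓ k (suc d) = begin
  start ℓ k + (span ℓ k d + ℓ (k + d))   ≡⟨ +-assoc (start ℓ k) _ _ ⟨
  start ℓ k + span ℓ k d + ℓ (k + d)     ≡⟨ cong (_+ ℓ (k + d)) (start-+-span ℓ k d) ⟩
  start ℓ (suc (k + d))                  ≡⟨ cong (start ℓ) (+-suc k d) ⟨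
  start ℓ (k + suc d)                    ∎
  where open ≡-Reasoning

span-locate : ∀ {ℓ} → (∀ k → 1 ≤ ℓ k) →
              ∀ k n → ∃₂ λ d t → span ℓ k d + t ≡ n × t < ℓ (k + d)
span-locate nonempty k zero = 0 , 0 , refl , nonempty (k + 0)
span-locate {ℓ} nonempty k (suc n) with span-locate nonempty k n
... | d , t , n≡ , t<ℓ with m≤n⇒m<n∨m≡n t<ℓ
...   | inj₁ 1+t<ℓ = d , suc t , trans (+-suc _ t) (cong suc n≡) , 1+t<ℓ
...   | inj₂ 1+t≡ℓ = suc d , 0 , n+1≡ , nonempty (k + suc d)
  where
  n+1≡ : span ℓ k d + ℓ (k + d) + 0 ≡ suc n
  n+1≡ = begin
    span ℓ k d + ℓ (k + d) + 0   ≡⟨ +-identityʳ _ ⟩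
    span ℓ k d + ℓ (k + d)       ≡⟨ cong (span ℓ k d +_) 1+t≡ℓ ⟨
    span ℓ k d + suc t           ≡⟨ +-suc _ t ⟩
    suc (span ℓ k d + t)         ≡⟨ cong suc n≡ ⟩
    suc n                        ∎
    where open ≡-Reasoning

module RichPrefixBlocks (x : Word) (a : Letter) (ℓ : ℕ → ℕ)
  (nonempty : ∀ k → 1 ≤ ℓ k)
  (block≡prefix : ∀ k j → j < ℓ k → x (start ℓ k + j) ≡ x j)
  (rich : ∀ k → RichPrefix x a (ℓ k)) where

  open Occurrences x a

  block-rich : ∀ k → RichFactor x a (start ℓ k) (ℓ k)
  block-rich k = RichFactor-cong (ℓ k) (λ j j<ℓ → sym (block≡prefix k j j<ℓ)) (rich k)

  span-rich : ∀ k d → RichFactor x a (start ℓ k) (span ℓ k d)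
  span-rich k zero    _ = z≤n
  span-rich k (suc d)   = RichFactor-++ (span ℓ k d) (ℓ (k + d)) (span-rich k d)
    (subst (λ i → RichFactor x a i (ℓ (k + d))) (sym (start-+-span ℓ k d)) (block-rich (k + d)))

  start-rich : ∀ k → RichPrefix x a (start ℓ k)
  start-rich k = subst (RichPrefix x a) (start-+-span ℓ 0 k) (span-rich 0 k)

  ShiftsBelow : ℕ → Set
  ShiftsBelow n = ∀ {u} → u < n → ∀ k → x (start ℓ k + u) ≡ x u

  shift-count-≤ : ∀ n → ShiftsBelow n → ∀ k → count a (x (start ℓ k + n)) ≤ count a (x n)
  shift-count-≤ n below k = RichPrefix-shift-count (start ℓ k) n (start-rich k) (λ j j<n → below j<n k)

  shift-count-≥ : ∀ n → ShiftsBelow n → ∀ k → count a (x n) ≤ count a (x (start ℓ k + n))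
  shift-count-≥ n below k with span-locate nonempty k n
  ... | d , t , refl , t<ℓ =
    subst (λ b → count a (x (D + t)) ≤ count a b) (sym (in-block t t<ℓ))
      (RichPrefix-shift-count D t D-rich period)
    where
    D : ℕ
    D = span ℓ k d

    in-block : ∀ j → j < ℓ (k + d) → x (start ℓ k + (D + j)) ≡ x j
    in-block j j<ℓ = begin
      x (start ℓ k + (D + j))     ≡⟨ cong x (+-assoc (start ℓ k) D j) ⟨
      x (start ℓ k + D + j)       ≡⟨ cong (λ i → x (i + j)) (start-+-span ℓ k d) ⟩
      x (start ℓ (k + d) + j)     ≡⟨ block≡prefix (k + d) j j<ℓ ⟩
      x j                         ∎
      where open ≡-Reasoning

    D-rich : RichPrefix x a D
    D-rich = RichFactor-cong D (λ j j<D → below (<-≤-trans j<D (m≤m+n D t)) k)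
               (span-rich k d)

    period : ∀ j → j < t → x (D + j) ≡ x j
    period j j<t = trans (sym (below (+-monoʳ-< D j<t) k))
                         (in-block j (<-trans j<t t<ℓ))

  shift : ∀ n k → x (start ℓ k + n) ≡ x n
  shift = <-rec (λ n → ∀ k → x (start ℓ k + n) ≡ x n) λ n below k →
    count-injective a (≤-antisym (shift-count-≤ n below k) (shift-count-≥ n below k))

corollary2 : (x : Word) (a : Letter) → RichPrefixFactorisation x a → Periodic x
corollary2 x a (ℓ , H) = ℓ 0 , proj₁ (H 0) , λ n → trans (cong x (+-comm n (ℓ 0))) (shift n 1)
  where
  open RichPrefixBlocks x a ℓ
    (λ k → proj₁ (H k)) (λ k → proj₁ (proj₂ (H k))) (λ k → proj₂ (proj₂ (H k)))
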